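{- For every prime $p \geq 11$, $$P(p,3) \leq (p-1)! - \left\lceil \frac{p}{3} \right\rceil + 2 \leq (p-1)! - 2.$$
   Context: $S_n$ denotes the set (group) of all permutations of $[n]=\{1,\dots,n\}$. For $\rho,\pi\in S_n$, the Kendall $\tau$-distance $d_K(\rho,\pi)$ is the minimum number of adjacent transpositions needed to transform $\rho$ into $\pi$. Here applying the adjacent transposition $(i,i+1)$, $1\le i\le n-1$, to $\pi=[\pi(1),\dots,\pi(n)]$ swaps the entries in positions $i$ and $i+1$. Equivalently, $d_K$ is the graph distance in the Cayley graph of $S_n$ with respect to $\{(i,i+1): 1\le i\le n-1\}$. $P(n,d)$ denotes the maximum size of a non-empty subset $\mathcal{C}\subseteq S_n$ such that $d_K(x,y)\ge d$ for all distinct $x,y\in\mathcal{C}$. -}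

module Defs where

open import Data.Nat using (ℕ; zero; suc; _+_; _<_; _≥_; _≤_)
open import Data.Fin using (Fin)
open import Data.Fin.Permutation using (Permutation′; _⟨$⟩ʳ_)
open import Data.Vec using (Vec; []; _∷_; tabulate)
open import Data.List using (List; length)
open import Data.List.Relation.Unary.AllPairs using (AllPairs)
open import Data.Product using (_×_)
open import Relation.Nullary using (¬_)
open import Relation.Binary.PropositionalEquality using (_≡_)

oneLine : {n : ℕ} → Permutation′ n → Vec (Fin n) n
oneLine π = tabulate (π ⟨$⟩ʳ_)

data AdjSwap {A : Set} : {n : ℕ} → Vec A n → Vec A n → Set where
  here  : {n : ℕ} {x y : A} {xs : Vec A n} →
          AdjSwap (x ∷ y ∷ xs) (y ∷ x ∷ xs)
  there : {n : ℕ} {x : A} {xs ys : Vec A n} →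
          AdjSwap xs ys → AdjSwap (x ∷ xs) (x ∷ ys)

data Steps {A : Set} {n : ℕ} : ℕ → Vec A n → Vec A n → Set where
  done : {u : Vec A n} → Steps zero u u
  step : {k : ℕ} {u v w : Vec A n} → AdjSwap u v → Steps k v w → Steps (suc k) u w

-- d_K(ρ,π) ≥ d : the minimum number of adjacent transpositions transforming ρ into π
-- is at least d, i.e. no sequence of fewer than d of them works.
KendallAtLeast : {n : ℕ} → ℕ → Permutation′ n → Permutation′ n → Set
KendallAtLeast {n} d ρ π = (k : ℕ) → k < d → ¬ Steps k (oneLine ρ) (oneLine π)

IsCode : (n d : ℕ) → List (Permutation′ n) → Set
IsCode n d C =
  AllPairs (λ x y → (¬ oneLine x ≡ oneLine y) × KendallAtLeast d x y) C

PAtMost : (n d N : ℕ) → Set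
PAtMost n d N = (C : List (Permutation′ n)) → IsCode n d C → length C ≤ N

-- In a code C ⊆ S_p of minimum Kendall τ-distance 3 the radius-one balls around the code words are disjoint.
-- Fix a position j and count the permutations with the symbol 0 (the paper's 1) at position j that lie in
-- these balls: there are at most (p − 1)!, and the ball around a code word contributes its entries at the
-- positions j − 1 and j + 1 and p − 2 times its entry at j. So c(j − 1) + (p − 2) c(j) + c(j + 1) ≤ (p − 1)!,
-- where c(i) counts the code words with 0 at position i. By Wilson's theorem (p − 1)! + 1 = p q, so each of
-- these local sums is strictly below p q, which the uniform value c ≡ q would reach. Averaging the local bounds
-- over all positions gives 3 |C| + p ≤ 3 ((p − 1)! + 1), that is |C| ≤ (p − 1)! + 1 − ⌈p/3⌉.

module Submission where

open import Defs
open import Data.Nat using (ℕ; _+_; _∸_; _≤_; _/_; _!)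
open import Data.Nat.Primality using (Prime)
open import Data.Product using (_×_)

open import Algebra.Properties.CommutativeSemigroup using (interchange; xy∙z≈xz∙y; x∙yz≈y∙xz)
open import Data.Empty using (⊥-elim)
open import Data.Fin using (Fin; zero; suc) renaming (_≟_ to _≟F_)
open import Data.Fin.Permutation using (Permutation′; _⟨$⟩ʳ_; _⟨$⟩ˡ_; inverseˡ; inverseʳ)
open import Data.Fin.Properties using () renaming (suc-injective to Fin-suc-injective)
open import Data.List using (List; []; _∷_; length; map; concat; _++_; applyDownFrom; allFin)
open import Data.List.Membership.Propositional using (_∈_)
open import Data.List.Membership.Propositional.Properties
  using (∈-applyDownFrom⁺; ∈-applyDownFrom⁻; ∈-map⁺; ∈-map⁻; ∈-allFin)
open import Data.List.Properties using (length-map; length-tabulate)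
open import Data.List.Relation.Binary.Disjoint.Propositional using (Disjoint)
open import Data.List.Relation.Unary.All as All using (All; []; _∷_)
import Data.List.Relation.Unary.All.Properties as All
open import Data.List.Relation.Unary.AllPairs as AllPairs using (AllPairs; []; _∷_)
import Data.List.Relation.Unary.AllPairs.Properties as AllPairs
open import Data.List.Relation.Unary.Any using (here; there)
open import Data.List.Relation.Unary.Unique.Propositional using (Unique)
import Data.List.Relation.Unary.Unique.Propositional.Properties as Unique
open import Data.Nat hiding (_≟_)
open import Data.Nat.Coprimality using (prime⇒coprime; coprime-Bézout)
open import Data.Nat.DivMod
open import Data.Nat.Divisibility using (_∣_; divides; ∣⇒≤)
open import Data.Nat.GCD using (module Bézout)
open import Data.Nat.ListAction using (product)
open import Data.Nat.Primality using (euclidsLemma; ¬prime[0]; ¬prime[1])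
open import Data.Nat.Properties renaming (_≟_ to _≟ℕ_)
open import Data.Nat.Solver using (module +-*-Solver)
open import Data.Product using (∃-syntax; _,_; proj₁; proj₂; map₁; map₂)
open import Data.Sum using (_⊎_; inj₁; inj₂)
open import Data.Vec using (Vec; []; _∷_; head)
import Data.Vec.Properties as Vec
open import Data.Vec.Membership.Propositional using () renaming (_∈_ to _∈ᵥ_)
open import Data.Vec.Membership.Propositional.Properties using (∈-tabulate⁺)
open import Data.Vec.Relation.Unary.All as VecAll using ([]; _∷_)
open import Data.Vec.Relation.Unary.AllPairs using ([]; _∷_)
open import Data.Vec.Relation.Unary.Any using (here; there)
open import Data.Vec.Relation.Unary.Unique.Propositional using () renaming (Unique to Distinct)
import Data.Vec.Relation.Unary.Unique.Propositional.Properties as Distinct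
open import Function using (_∘_)
open import Relation.Binary.Definitions using (DecidableEquality)
open import Relation.Binary.PropositionalEquality
open import Relation.Nullary using (¬_; yes; no)

open +-*-Solver

sumBelow : ℕ → (ℕ → ℕ) → ℕ
sumBelow zero    f = 0
sumBelow (suc n) f = sumBelow n f + f n

sumBelow-mono-≤ : ∀ n {f g : ℕ → ℕ} → (∀ j → j < n → f j ≤ g j) → sumBelow n f ≤ sumBelow n g
sumBelow-mono-≤ zero    f≤g = z≤n
sumBelow-mono-≤ (suc n) f≤g = +-mono-≤ (sumBelow-mono-≤ n (λ j j<n → f≤g j (m<n⇒m<1+n j<n))) (f≤g n ≤-refl)

sumBelow-cong : ∀ n {f g : ℕ → ℕ} → (∀ j → j < n → f j ≡ g j) → sumBelow n f ≡ sumBelow n g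
sumBelow-cong zero    f≡g = refl
sumBelow-cong (suc n) f≡g = cong₂ _+_ (sumBelow-cong n (λ j j<n → f≡g j (m<n⇒m<1+n j<n))) (f≡g n ≤-refl)

sumBelow-distrib-+ : ∀ n (f g : ℕ → ℕ) → sumBelow n (λ j → f j + g j) ≡ sumBelow n f + sumBelow n g
sumBelow-distrib-+ zero    f g = refl
sumBelow-distrib-+ (suc n) f g = begin
  sumBelow n (λ j → f j + g j) + (f n + g n)     ≡⟨ cong (_+ (f n + g n)) (sumBelow-distrib-+ n f g) ⟩
  (sumBelow n f + sumBelow n g) + (f n + g n)    ≡⟨ interchange +-commutativeSemigroup (sumBelow n f) _ _ _ ⟩
  (sumBelow n f + f n) + (sumBelow n g + g n)    ∎
  where open ≡-Reasoning

sumBelow-distribˡ-* : ∀ n k (f : ℕ → ℕ) → sumBelow n (λ j → k * f j) ≡ k * sumBelow n f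
sumBelow-distribˡ-* zero    k f = sym (*-zeroʳ k)
sumBelow-distribˡ-* (suc n) k f =
  trans (cong (_+ k * f n) (sumBelow-distribˡ-* n k f)) (sym (*-distribˡ-+ k (sumBelow n f) (f n)))

sumBelow-const : ∀ n c → sumBelow n (λ _ → c) ≡ n * c
sumBelow-const zero    c = refl
sumBelow-const (suc n) c = trans (cong (_+ c) (sumBelow-const n c)) (+-comm (n * c) c)

sumBelow-suc : ∀ n (f : ℕ → ℕ) → sumBelow (suc n) f ≡ f 0 + sumBelow n (f ∘ suc)
sumBelow-suc zero    f = +-comm 0 (f 0)
sumBelow-suc (suc n) f = trans (cong (_+ f (suc n)) (sumBelow-suc n f)) (+-assoc (f 0) _ _)

-- Positions are 0,…,n-1; the left neighbour of j is pred j and the end positions are their own outer neighbours.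
rightNeighbour : ℕ → ℕ → ℕ
rightNeighbour n j = suc j ⊓ pred n

sumBelow-neighbours : ∀ n (g : ℕ → ℕ) →
  sumBelow (suc n) (g ∘ pred) + sumBelow (suc n) (g ∘ rightNeighbour (suc n)) ≡ 2 * sumBelow (suc n) g
sumBelow-neighbours n g = begin
  sumBelow (suc n) (g ∘ pred) + sumBelow (suc n) (g ∘ rightNeighbour (suc n))
    ≡⟨ cong₂ _+_ (sumBelow-suc n (g ∘ pred)) (cong₂ _+_ (sumBelow-cong n inner) (cong g last)) ⟩
  (g 0 + sumBelow n g) + (sumBelow n (g ∘ suc) + g n)
    ≡⟨ solve 4 (λ a b c d → (a :+ b) :+ (c :+ d) := (b :+ d) :+ ((a :+ c) :+ con 0)) refl
         (g 0) (sumBelow n g) (sumBelow n (g ∘ suc)) (g n) ⟩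
  sumBelow (suc n) g + ((g 0 + sumBelow n (g ∘ suc)) + 0)
    ≡⟨ cong (λ s → sumBelow (suc n) g + (s + 0)) (sym (sumBelow-suc n g)) ⟩
  2 * sumBelow (suc n) g ∎
  where
    open ≡-Reasoning
    inner : ∀ j → j < n → g (rightNeighbour (suc n) j) ≡ g (suc j)
    inner j j<n = cong g (m≤n⇒m⊓n≡m j<n)
    last : rightNeighbour (suc n) n ≡ n
    last = m≥n⇒m⊓n≡n (n≤1+n n)

-- The averaging inequality

m+[n∸m]≡n+[m∸n] : ∀ m n → m + (n ∸ m) ≡ n + (m ∸ n)
m+[n∸m]≡n+[m∸n] zero    zero    = refl
m+[n∸m]≡n+[m∸n] zero    (suc n) = sym (+-identityʳ (suc n))
m+[n∸m]≡n+[m∸n] (suc m) zero    = +-identityʳ (suc m)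
m+[n∸m]≡n+[m∸n] (suc m) (suc n) = cong suc (m+[n∸m]≡n+[m∸n] m n)

excess<deficits : ∀ k q a b x → a + k * b + x < (2 + k) * q →
  k * (b ∸ q) < (q ∸ a) + (q ∸ b) + (q ∸ x)
excess<deficits k q a b x bound with b <? q
... | yes b<q = begin-strict
  k * (b ∸ q)                   ≡⟨ cong (k *_) (m≤n⇒m∸n≡0 (<⇒≤ b<q)) ⟩
  k * 0                         ≡⟨ *-zeroʳ k ⟩
  0                             <⟨ m<n⇒0<n∸m b<q ⟩
  q ∸ b                         ≤⟨ m≤n+m (q ∸ b) (q ∸ a) ⟩
  (q ∸ a) + (q ∸ b)             ≤⟨ m≤m+n _ (q ∸ x) ⟩
  (q ∸ a) + (q ∸ b) + (q ∸ x)   ∎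
  where open ≤-Reasoning
... | no b≮q = begin-strict
  k * e                         <⟨ +-cancelˡ-< (a + x) _ _ (+-cancelʳ-< (k * q) _ _ excess) ⟩
  (q ∸ a) + (q ∸ x)             ≤⟨ m≤m+n _ (q ∸ b) ⟩
  (q ∸ a) + (q ∸ x) + (q ∸ b)   ≡⟨ xy∙z≈xz∙y +-commutativeSemigroup (q ∸ a) (q ∸ x) (q ∸ b) ⟩
  (q ∸ a) + (q ∸ b) + (q ∸ x)   ∎
  where
    open ≤-Reasoning
    e = b ∸ q
    b≡q+e : b ≡ q + e
    b≡q+e = sym (m+[n∸m]≡n (≮⇒≥ b≮q))
    excess : (a + x) + k * e + k * q < (a + x) + ((q ∸ a) + (q ∸ x)) + k * q
    excess = begin-strict
      (a + x) + k * e + k * q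
        ≡⟨ solve 5 (λ a x k e q → (a :+ x) :+ k :* e :+ k :* q := a :+ k :* (q :+ e) :+ x) refl a x k e q ⟩
      a + k * (q + e) + x
        ≡⟨ cong (λ z → a + k * z + x) (sym b≡q+e) ⟩
      a + k * b + x
        <⟨ bound ⟩
      (2 + k) * q
        ≡⟨ solve 2 (λ k q → (con 2 :+ k) :* q := (q :+ q) :+ k :* q) refl k q ⟩
      (q + q) + k * q
        ≤⟨ +-monoˡ-≤ (k * q) (+-mono-≤ (m≤n+m∸n q a) (m≤n+m∸n q x)) ⟩
      (a + (q ∸ a)) + (x + (q ∸ x)) + k * q
        ≡⟨ cong (_+ k * q) (interchange +-commutativeSemigroup a (q ∸ a) x (q ∸ x)) ⟩
      (a + x) + ((q ∸ a) + (q ∸ x)) + k * q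
        ∎

-- With excess j = c j ∸ q and deficit j = q ∸ c j, the local bound at j makes k · excess j smaller than the sum of
-- the deficits at j and its two neighbours. Each deficit is counted at most three times, so k E + n ≤ 3 D, and since
-- Σ c + D = n q + E and k ≥ 3 this gives 3 Σ c + n ≤ 3 n q.
averaging-bound : ∀ k q (c : ℕ → ℕ) → 3 ≤ k →
  (∀ j → j < 2 + k → c (pred j) + k * c j + c (rightNeighbour (2 + k) j) < (2 + k) * q) →
  3 * sumBelow (2 + k) c + (2 + k) ≤ 3 * ((2 + k) * q)
averaging-bound k q c 3≤k local = +-cancelʳ-≤ (3 * D) _ _ (begin
  3 * S + n + 3 * D
    ≡⟨ solve 3 (λ s n d → con 3 :* s :+ n :+ con 3 :* d := con 3 :* (s :+ d) :+ n) refl S n D ⟩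
  3 * (S + D) + n
    ≡⟨ cong (λ z → 3 * z + n) balance ⟩
  3 * (n * q + E) + n
    ≡⟨ solve 3 (λ a e n → con 3 :* (a :+ e) :+ n := con 3 :* a :+ (con 3 :* e :+ n)) refl (n * q) E n ⟩
  3 * (n * q) + (3 * E + n)
    ≤⟨ +-monoʳ-≤ (3 * (n * q)) (+-monoˡ-≤ n (*-monoˡ-≤ E 3≤k)) ⟩
  3 * (n * q) + (k * E + n)
    ≤⟨ +-monoʳ-≤ (3 * (n * q)) weighted-excess≤deficits ⟩
  3 * (n * q) + 3 * D
    ∎)
  where
    open ≤-Reasoning
    n = 2 + k
    deficit excess : ℕ → ℕ
    deficit j = q ∸ c j
    excess j = c j ∸ q
    S = sumBelow n c
    D = sumBelow n deficit
    E = sumBelow n excess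

    balance : S + D ≡ n * q + E
    balance = begin-equality
      S + D                                 ≡⟨ sym (sumBelow-distrib-+ n c deficit) ⟩
      sumBelow n (λ j → c j + deficit j)    ≡⟨ sumBelow-cong n (λ j _ → m+[n∸m]≡n+[m∸n] (c j) q) ⟩
      sumBelow n (λ j → q + excess j)       ≡⟨ sumBelow-distrib-+ n (λ _ → q) excess ⟩
      sumBelow n (λ _ → q) + E              ≡⟨ cong (_+ E) (sumBelow-const n q) ⟩
      n * q + E                             ∎

    weighted-excess≤deficits : k * E + n ≤ 3 * D
    weighted-excess≤deficits = begin
      k * E + n
        ≡⟨ +-comm (k * E) n ⟩
      n + k * E
        ≡⟨ cong₂ _+_ (sym (trans (sumBelow-const n 1) (*-identityʳ n))) (sym (sumBelow-distribˡ-* n k excess)) ⟩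
      sumBelow n (λ _ → 1) + sumBelow n (λ j → k * excess j)
        ≡⟨ sym (sumBelow-distrib-+ n (λ _ → 1) (λ j → k * excess j)) ⟩
      sumBelow n (λ j → 1 + k * excess j)
        ≤⟨ sumBelow-mono-≤ n (λ j j<n →
             excess<deficits k q (c (pred j)) (c j) (c (rightNeighbour n j)) (local j j<n)) ⟩
      sumBelow n (λ j → deficit (pred j) + deficit j + deficit (rightNeighbour n j))
        ≡⟨ sumBelow-distrib-+ n (λ j → deficit (pred j) + deficit j) (deficit ∘ rightNeighbour n) ⟩
      sumBelow n (λ j → deficit (pred j) + deficit j) + R
        ≡⟨ cong (_+ R) (sumBelow-distrib-+ n (deficit ∘ pred) deficit) ⟩
      L + D + R
        ≡⟨ xy∙z≈xz∙y +-commutativeSemigroup L D R ⟩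
      L + R + D
        ≡⟨ cong (_+ D) (sumBelow-neighbours (suc k) deficit) ⟩
      2 * D + D
        ≡⟨ solve 1 (λ d → con 2 :* d :+ d := con 3 :* d) refl D ⟩
      3 * D ∎
      where
        L = sumBelow n (deficit ∘ pred)
        R = sumBelow n (deficit ∘ rightNeighbour n)

module Removal {A : Set} (_≟_ : DecidableEquality A) where

  remove : A → List A → List A
  remove b []       = []
  remove b (x ∷ xs) with x ≟ b
  ... | yes _ = xs
  ... | no  _ = x ∷ remove b xs

  length-remove : ∀ {b} xs → b ∈ xs → suc (length (remove b xs)) ≡ length xs
  length-remove {b} (x ∷ xs) b∈ with x ≟ b
  length-remove {b} (x ∷ xs) b∈          | yes _   = refl
  length-remove {b} (x ∷ xs) (here b≡x)  | no  x≢b = ⊥-elim (x≢b (sym b≡x))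
  length-remove {b} (x ∷ xs) (there b∈)  | no  _   = cong suc (length-remove xs b∈)

  ∈-remove⁻ : ∀ {b c} xs → c ∈ remove b xs → c ∈ xs
  ∈-remove⁻ {b} (x ∷ xs) c∈ with x ≟ b
  ∈-remove⁻ {b} (x ∷ xs) c∈          | yes _ = there c∈
  ∈-remove⁻ {b} (x ∷ xs) (here c≡x)  | no  _ = here c≡x
  ∈-remove⁻ {b} (x ∷ xs) (there c∈)  | no  _ = there (∈-remove⁻ xs c∈)

  ∈-remove⁺ : ∀ {b c} xs → c ∈ xs → c ≢ b → c ∈ remove b xs
  ∈-remove⁺ {b} (x ∷ xs) c∈ c≢b with x ≟ b
  ∈-remove⁺ {b} (x ∷ xs) (here refl) c≢b | yes x≡b = ⊥-elim (c≢b x≡b)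
  ∈-remove⁺ {b} (x ∷ xs) (there c∈)  c≢b | yes _   = c∈
  ∈-remove⁺ {b} (x ∷ xs) (here c≡x)  c≢b | no  _   = here c≡x
  ∈-remove⁺ {b} (x ∷ xs) (there c∈)  c≢b | no  _   = there (∈-remove⁺ xs c∈ c≢b)

  remove-unique : ∀ {b} xs → Unique xs → Unique (remove b xs)
  remove-unique {b} []       []          = []
  remove-unique {b} (x ∷ xs) (x∉ ∷ uxs) with x ≟ b
  ... | yes _ = uxs
  ... | no  _ = All.tabulate (λ c∈ → All.lookup x∉ (∈-remove⁻ xs c∈)) ∷ remove-unique xs uxs

  ∈-remove⇒≢ : ∀ {b c} xs → Unique xs → c ∈ remove b xs → c ≢ b
  ∈-remove⇒≢ {b} (x ∷ xs) (x∉ ∷ uxs) c∈ with x ≟ b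
  ∈-remove⇒≢ {b} (x ∷ xs) (x∉ ∷ uxs) c∈          | yes refl = λ { refl → All.lookup x∉ c∈ refl }
  ∈-remove⇒≢ {b} (x ∷ xs) (x∉ ∷ uxs) (here refl) | no  x≢b  = x≢b
  ∈-remove⇒≢ {b} (x ∷ xs) (x∉ ∷ uxs) (there c∈)  | no  _    = ∈-remove⇒≢ xs uxs c∈

open Removal _≟ℕ_ using () renaming (remove to removeℕ)

product-remove : ∀ {b} xs → b ∈ xs → product xs ≡ b * product (removeℕ b xs)
product-remove {b} (x ∷ xs) b∈ with x ≟ℕ b
product-remove {b} (x ∷ xs) b∈          | yes refl = refl
product-remove {b} (x ∷ xs) (here b≡x)  | no  x≢b  = ⊥-elim (x≢b (sym b≡x))
product-remove {b} (x ∷ xs) (there b∈)  | no  _    = begin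
  x * product xs                    ≡⟨ cong (x *_) (product-remove xs b∈) ⟩
  x * (b * product (removeℕ b xs))  ≡⟨ x∙yz≈y∙xz *-commutativeSemigroup x b _ ⟩
  b * (x * product (removeℕ b xs))  ∎
  where open ≡-Reasoning

-- Wilson's theorem

module ModularUnits {m : ℕ} (p-prime : Prime (2 + m)) where

  p : ℕ
  p = 2 + m

  1%p≡1 : 1 % p ≡ 1
  1%p≡1 = m<n⇒m%n≡m {n = p} (s≤s (s≤s z≤n))

  %≡%⇒∣∸ : ∀ {a b} → a % p ≡ b % p → a ≤ b → p ∣ b ∸ a
  %≡%⇒∣∸ {a} {b} a≡b a≤b = divides (b / p ∸ a / p) (begin
    b ∸ a                                     ≡⟨ cong₂ _∸_ (m≡m%n+[m/n]*n b p) (m≡m%n+[m/n]*n a p) ⟩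
    (b % p + b / p * p) ∸ (a % p + a / p * p) ≡⟨ cong (λ r → (b % p + b / p * p) ∸ (r + a / p * p)) a≡b ⟩
    (b % p + b / p * p) ∸ (b % p + a / p * p) ≡⟨ [m+n]∸[m+o]≡n∸o (b % p) _ _ ⟩
    b / p * p ∸ a / p * p                     ≡⟨ sym (*-distribʳ-∸ p (b / p) (a / p)) ⟩
    (b / p ∸ a / p) * p                       ∎)
    where open ≡-Reasoning

  private
    *-cancelˡ-%-≤ : ∀ {a b c} → 0 < a → a < p → c < p → (a * b) % p ≡ (a * c) % p → b ≤ c → b ≡ c
    *-cancelˡ-%-≤ {a} {b} {c} 0<a a<p c<p ab≡ac b≤c
      with euclidsLemma a (c ∸ b) p-prime
             (subst (p ∣_) (sym (*-distribˡ-∸ a c b)) (%≡%⇒∣∸ ab≡ac (*-monoʳ-≤ a b≤c)))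
    ... | inj₁ p∣a   = ⊥-elim (<⇒≱ a<p (∣⇒≤ {{>-nonZero 0<a}} p∣a))
    ... | inj₂ p∣c∸b with c ∸ b in c∸b≡
    ...   | zero  = ≤-antisym b≤c (m∸n≡0⇒m≤n c∸b≡)
    ...   | suc _ = ⊥-elim (<⇒≱ c<p (≤-trans (∣⇒≤ p∣c∸b) (subst (_≤ c) c∸b≡ (m∸n≤m c b))))

  *-cancelˡ-% : ∀ {a b c} → 0 < a → a < p → b < p → c < p → (a * b) % p ≡ (a * c) % p → b ≡ c
  *-cancelˡ-% 0<a a<p b<p c<p ab≡ac with ≤-total _ _
  ... | inj₁ b≤c = *-cancelˡ-%-≤ 0<a a<p c<p ab≡ac b≤c
  ... | inj₂ c≤b = sym (*-cancelˡ-%-≤ 0<a a<p b<p (sym ab≡ac) c≤b)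

  inverse-unique : ∀ {a b c} → 0 < b → b < p → a < p → c < p → (a * b) % p ≡ 1 → (c * b) % p ≡ 1 → a ≡ c
  inverse-unique {a} {b} {c} 0<b b<p a<p c<p ab≡1 cb≡1 =
    *-cancelˡ-% 0<b b<p a<p c<p
      (trans (cong (_% p) (*-comm b a)) (trans ab≡1 (trans (sym cb≡1) (cong (_% p) (*-comm c b)))))

  self-inverse : ∀ {a} → 0 < a → a < p → (a * a) % p ≡ 1 → a ≡ 1 ⊎ a ≡ suc m
  self-inverse {suc a} _ a<p a²≡1
    with euclidsLemma a (2 + a) p-prime
           (subst (p ∣_) (sym (*-suc a (suc a))) (%≡%⇒∣∸ (trans 1%p≡1 (sym a²≡1)) (s≤s z≤n)))
  ... | inj₂ p∣a+2 = inj₂ (≤-antisym (s≤s⁻¹ a<p) (s≤s⁻¹ (∣⇒≤ p∣a+2)))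
  ... | inj₁ p∣a with a
  ...   | zero   = inj₁ refl
  ...   | suc a′ = ⊥-elim (<⇒≱ a<p (≤-trans (∣⇒≤ p∣a) (n≤1+n (suc a′))))

  m*[n%p]%p≡m*n%p : ∀ a b → (a * (b % p)) % p ≡ (a * b) % p
  m*[n%p]%p≡m*n%p a b = begin
    (a * (b % p)) % p           ≡⟨ %-distribˡ-* a (b % p) p ⟩
    ((a % p) * (b % p % p)) % p ≡⟨ cong (λ z → ((a % p) * z) % p) (m%n%n≡m%n b p) ⟩
    ((a % p) * (b % p)) % p     ≡⟨ sym (%-distribˡ-* a b p) ⟩
    (a * b) % p                 ∎
    where open ≡-Reasoning

  inverse : ∀ {a} → 0 < a → a < p → ∃[ b ] 0 < b × b < p × (a * b) % p ≡ 1
  inverse {a} 0<a a<p = reduce (fromBézout (coprime-Bézout (prime⇒coprime p-prime {{>-nonZero 0<a}} a<p)))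
    where
      open ≡-Reasoning
      fromBézout : Bézout.Identity 1 p a → ∃[ b ] (a * b) % p ≡ 1
      fromBézout (Bézout.Identity.-+ x y 1+xp≡ya) = y , (begin
        (a * y) % p     ≡⟨ cong (_% p) (trans (*-comm a y) (sym 1+xp≡ya)) ⟩
        (1 + x * p) % p ≡⟨ [m+kn]%n≡m%n 1 x p ⟩
        1 % p           ≡⟨ 1%p≡1 ⟩
        1               ∎)
      -- Here a · y ≡ −1, so y · (p − 1) is the inverse.
      fromBézout (Bézout.Identity.+- x y 1+ya≡xp) = y * suc m , (begin
        (a * (y * suc m)) % p
          ≡⟨ sym ([m+kn]%n≡m%n (a * (y * suc m)) 1 p) ⟩
        (a * (y * suc m) + 1 * p) % p
          ≡⟨ cong (_% p) (solve 3 (λ a y m → a :* (y :* (con 1 :+ m)) :+ con 1 :* (con 2 :+ m)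
                                           := (con 1 :+ y :* a) :* (con 1 :+ m) :+ con 1) refl a y m) ⟩
        ((1 + y * a) * suc m + 1) % p
          ≡⟨ cong (λ z → (z * suc m + 1) % p) 1+ya≡xp ⟩
        ((x * p) * suc m + 1) % p
          ≡⟨ cong (_% p) (solve 2 (λ x m → (x :* (con 2 :+ m)) :* (con 1 :+ m) :+ con 1
                                         := con 1 :+ (x :* (con 1 :+ m)) :* (con 2 :+ m)) refl x m) ⟩
        (1 + (x * suc m) * p) % p
          ≡⟨ [m+kn]%n≡m%n 1 (x * suc m) p ⟩
        1 % p
          ≡⟨ 1%p≡1 ⟩
        1 ∎)
      reduce : ∃[ b ] (a * b) % p ≡ 1 → ∃[ b ] 0 < b × b < p × (a * b) % p ≡ 1
      reduce (b , ab≡1) with b % p in b%p≡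
      ... | zero  = ⊥-elim (0≢1+n (begin
        0                   ≡⟨ cong (_% p) (sym (*-zeroʳ a)) ⟩
        (a * 0) % p         ≡⟨ cong (λ z → (a * z) % p) (sym b%p≡) ⟩
        (a * (b % p)) % p   ≡⟨ m*[n%p]%p≡m*n%p a b ⟩
        (a * b) % p         ≡⟨ ab≡1 ⟩
        1                   ∎))
      ... | suc r = suc r , s≤s z≤n , subst (_< p) b%p≡ (m%n<n b p) ,
                    trans (cong (λ z → (a * z) % p) (sym b%p≡)) (trans (m*[n%p]%p≡m*n%p a b) ab≡1)

  [p-1]²%p≡1 : (suc m * suc m) % p ≡ 1
  [p-1]²%p≡1 = trans (cong (_% p) (solve 1 (λ m → (con 1 :+ m) :* (con 1 :+ m) := con 1 :+ m :* (con 2 :+ m)) refl m))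
                     (trans ([m+kn]%n≡m%n 1 m p) 1%p≡1)

  open Removal _≟ℕ_

  InUnitRange : List ℕ → Set
  InUnitRange L = ∀ {a} → a ∈ L → 0 < a × a < p

  ClosedUnderDistinctInverse : List ℕ → Set
  ClosedUnderDistinctInverse L = ∀ {a} → a ∈ L → ∃[ b ] b ∈ L × b ≢ a × (a * b) % p ≡ 1

  -- The bound n on the length drives the recursion: each step removes an element and its inverse.
  product-inverse-pairs : ∀ n L → length L ≤ n → Unique L → InUnitRange L → ClosedUnderDistinctInverse L →
    product L % p ≡ 1
  product-inverse-pairs n       []         _              _            _     _      = 1%p≡1
  product-inverse-pairs (suc n) (a ∷ rest) (s≤s |rest|≤n) (a∉ ∷ urest) range closed with closed (here refl)
  ... | b , here b≡a , b≢a , _  = ⊥-elim (b≢a b≡a)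
  ... | b , there b∈ , _   , ab≡1 = begin
    (a * product rest) % p       ≡⟨ cong (λ z → (a * z) % p) (product-remove rest b∈) ⟩
    (a * (b * R)) % p            ≡⟨ cong (_% p) (sym (*-assoc a b R)) ⟩
    ((a * b) * R) % p            ≡⟨ %-distribˡ-* (a * b) R p ⟩
    (((a * b) % p) * (R % p)) % p ≡⟨ cong (λ z → (z * (R % p)) % p) ab≡1 ⟩
    (1 * (R % p)) % p            ≡⟨ cong (_% p) (*-identityˡ (R % p)) ⟩
    R % p % p                    ≡⟨ m%n%n≡m%n R p ⟩
    R % p                        ≡⟨ product-inverse-pairs n rest′ |rest′|≤n (remove-unique rest urest) range′ closed′ ⟩
    1                            ∎
    where
      open ≡-Reasoning
      rest′ = remove b rest
      R = product rest′
      |rest′|≤n : length rest′ ≤ n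
      |rest′|≤n = ≤-trans (n≤1+n _) (subst (_≤ n) (sym (length-remove rest b∈)) |rest|≤n)
      range′ : InUnitRange rest′
      range′ c∈ = range (there (∈-remove⁻ rest c∈))
      a-range = range (here refl)
      b-range = range (there b∈)
      closed′ : ClosedUnderDistinctInverse rest′
      closed′ {c} c∈ with closed (there (∈-remove⁻ rest c∈))
      ... | d , here refl , _ , cd≡1 =
        ⊥-elim (∈-remove⇒≢ rest urest c∈
          (inverse-unique (proj₁ a-range) (proj₂ a-range) (proj₂ (range′ c∈)) (proj₂ b-range)
            cd≡1 (trans (cong (_% p) (*-comm b a)) ab≡1)))
      ... | d , there d∈ , d≢c , cd≡1 with d ≟ℕ b
      ...   | yes refl = ⊥-elim (All.lookup a∉ (∈-remove⁻ rest c∈)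
                   (inverse-unique (proj₁ b-range) (proj₂ b-range) (proj₂ a-range) (proj₂ (range′ c∈))
                     ab≡1 cd≡1))
      ...   | no  d≢b  = d , ∈-remove⁺ rest d∈ d≢b , d≢c , cd≡1

product-applyDownFrom-2+ : ∀ n → product (applyDownFrom (2 +_) n) ≡ suc n !
product-applyDownFrom-2+ zero    = refl
product-applyDownFrom-2+ (suc n) = cong ((2 + n) *_) (product-applyDownFrom-2+ n)

-- The factors 2, …, p − 2 of (p − 1)! cancel in pairs {a, a⁻¹}, since only ±1 are their own inverses.
wilson : ∀ {p} → Prime p → p ∣ (p ∸ 1) ! + 1
wilson {0}                 p-prime = ⊥-elim (¬prime[0] p-prime)
wilson {1}                 p-prime = ⊥-elim (¬prime[1] p-prime)
wilson {2}                 _       = divides 1 refl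
wilson {suc (suc (suc m))} p-prime = divides (1 + suc (suc m) * (F / p)) (begin
  suc (suc m) * F + 1
    ≡⟨ cong (λ z → suc (suc m) * z + 1) (m≡m%n+[m/n]*n F p) ⟩
  suc (suc m) * (F % p + F / p * p) + 1
    ≡⟨ cong (λ z → suc (suc m) * (z + F / p * p) + 1) F%p≡1 ⟩
  suc (suc m) * (1 + F / p * p) + 1
    ≡⟨ solve 2 (λ m k → (con 2 :+ m) :* (con 1 :+ k :* (con 3 :+ m)) :+ con 1
                     := (con 1 :+ (con 2 :+ m) :* k) :* (con 3 :+ m)) refl m (F / p) ⟩
  (1 + suc (suc m) * (F / p)) * p ∎)
  where
    open ≡-Reasoning
    open ModularUnits {suc m} p-prime
    L = applyDownFrom (2 +_) m
    F = suc m !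

    range : ∀ {a} → a ∈ L → 2 ≤ a × a ≤ suc m
    range a∈ with ∈-applyDownFrom⁻ (2 +_) a∈
    ... | i , i<m , refl = s≤s (s≤s z≤n) , s≤s i<m

    unit-range : InUnitRange L
    unit-range a∈ = ≤-trans (s≤s z≤n) (proj₁ (range a∈)) , s≤s (m≤n⇒m≤1+n (proj₂ (range a∈)))

    closed : ClosedUnderDistinctInverse L
    closed {a} a∈ with inverse (proj₁ (unit-range a∈)) (proj₂ (unit-range a∈))
    ... | b , 0<b , b<p , ab≡1 = b , b∈L , b≢a , ab≡1
      where
        2≤a = proj₁ (range a∈)
        a≤m+1 = proj₂ (range a∈)
        b≢1 : b ≢ 1
        b≢1 refl = <⇒≢ 2≤a (sym (begin
          a           ≡⟨ sym (m<n⇒m%n≡m (proj₂ (unit-range a∈))) ⟩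
          a % p       ≡⟨ cong (_% p) (sym (*-identityʳ a)) ⟩
          (a * 1) % p ≡⟨ ab≡1 ⟩
          1           ∎))
        b≢p-1 : b ≢ suc (suc m)
        b≢p-1 refl =
          <⇒≢ (s≤s a≤m+1) (inverse-unique (s≤s z≤n) ≤-refl (proj₂ (unit-range a∈)) ≤-refl ab≡1 [p-1]²%p≡1)
        2≤b : 2 ≤ b
        2≤b = ≤∧≢⇒< 0<b (b≢1 ∘ sym)
        b≤m+1 : b ≤ suc m
        b≤m+1 = s≤s⁻¹ (≤∧≢⇒< (s≤s⁻¹ b<p) b≢p-1)
        b∈L : b ∈ L
        b∈L = subst (_∈ L) (m+[n∸m]≡n 2≤b)
                (∈-applyDownFrom⁺ (2 +_) (s≤s⁻¹ (subst (_≤ suc m) (sym (m+[n∸m]≡n 2≤b)) b≤m+1)))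
        b≢a : b ≢ a
        b≢a refl with self-inverse 0<b b<p ab≡1
        ... | inj₁ b≡1   = b≢1 b≡1
        ... | inj₂ b≡p-1 = b≢p-1 b≡p-1

    L-unique : Unique L
    L-unique = Unique.applyDownFrom⁺₁ (2 +_) m (λ j<i _ eq → <⇒≢ j<i (sym (+-cancelˡ-≡ 2 _ _ eq)))

    F%p≡1 : F % p ≡ 1
    F%p≡1 = trans (cong (_% p) (sym (product-applyDownFrom-2+ m)))
                  (product-inverse-pairs (length L) L ≤-refl L-unique unit-range closed)

-- Words with distinct letters

fallingFactorial : ℕ → ℕ → ℕ
fallingFactorial s zero    = 1
fallingFactorial s (suc k) = s * fallingFactorial (pred s) k

fallingFactorial-n-n : ∀ n → fallingFactorial n n ≡ n !
fallingFactorial-n-n zero    = refl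
fallingFactorial-n-n (suc n) = cong (suc n *_) (fallingFactorial-n-n n)

module DistinctWords {A : Set} (_≟_ : DecidableEquality A) where

  open Removal _≟_

  WordOver : ∀ {k} → List A → Vec A k → Set
  WordOver U w = Distinct w × VecAll.All (_∈ U) w

  splitByHead : ∀ {k} → A → List (Vec A (suc k)) → List (Vec A k) × List (Vec A (suc k))
  splitByHead u []             = [] , []
  splitByHead u ((x ∷ w) ∷ ws) with x ≟ u
  ... | yes _ = w ∷ proj₁ (splitByHead u ws) , proj₂ (splitByHead u ws)
  ... | no  _ = proj₁ (splitByHead u ws) , (x ∷ w) ∷ proj₂ (splitByHead u ws)

  module _ {k : ℕ} (u : A) where

    length-splitByHead : ∀ (ws : List (Vec A (suc k))) →
      length ws ≡ length (proj₁ (splitByHead u ws)) + length (proj₂ (splitByHead u ws))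
    length-splitByHead []             = refl
    length-splitByHead ((x ∷ w) ∷ ws) with x ≟ u
    ... | yes _ = cong suc (length-splitByHead ws)
    ... | no  _ = trans (cong suc (length-splitByHead ws)) (sym (+-suc _ _))

    ∈-splitByHead₁ : ∀ (ws : List (Vec A (suc k))) {w} → w ∈ proj₁ (splitByHead u ws) → (u ∷ w) ∈ ws
    ∈-splitByHead₁ ((x ∷ w) ∷ ws) w∈ with x ≟ u
    ∈-splitByHead₁ ((x ∷ w) ∷ ws) (here refl) | yes refl = here refl
    ∈-splitByHead₁ ((x ∷ w) ∷ ws) (there w∈)  | yes _    = there (∈-splitByHead₁ ws w∈)
    ∈-splitByHead₁ ((x ∷ w) ∷ ws) w∈          | no  _    = there (∈-splitByHead₁ ws w∈)

    ∈-splitByHead₂ : ∀ (ws : List (Vec A (suc k))) {v} → v ∈ proj₂ (splitByHead u ws) → v ∈ ws × head v ≢ u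
    ∈-splitByHead₂ ((x ∷ w) ∷ ws) v∈ with x ≟ u
    ∈-splitByHead₂ ((x ∷ w) ∷ ws) v∈          | yes _   = map₁ there (∈-splitByHead₂ ws v∈)
    ∈-splitByHead₂ ((x ∷ w) ∷ ws) (here refl) | no  x≢u = here refl , x≢u
    ∈-splitByHead₂ ((x ∷ w) ∷ ws) (there v∈)  | no  _   = map₁ there (∈-splitByHead₂ ws v∈)

    splitByHead-unique₁ : ∀ (ws : List (Vec A (suc k))) → Unique ws → Unique (proj₁ (splitByHead u ws))
    splitByHead-unique₁ []             []          = []
    splitByHead-unique₁ ((x ∷ w) ∷ ws) (x∉ ∷ uws) with x ≟ u
    ... | yes refl =
      All.tabulate (λ w′∈ w≡w′ → All.lookup x∉ (∈-splitByHead₁ ws w′∈) (cong (x ∷_) w≡w′))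
      ∷ splitByHead-unique₁ ws uws
    ... | no  _    = splitByHead-unique₁ ws uws

    splitByHead-unique₂ : ∀ (ws : List (Vec A (suc k))) → Unique ws → Unique (proj₂ (splitByHead u ws))
    splitByHead-unique₂ []             []          = []
    splitByHead-unique₂ ((x ∷ w) ∷ ws) (x∉ ∷ uws) with x ≟ u
    ... | yes _ = splitByHead-unique₂ ws uws
    ... | no  _ =
      All.tabulate (λ v∈ → All.lookup x∉ (proj₁ (∈-splitByHead₂ ws v∈))) ∷ splitByHead-unique₂ ws uws

  AllWordsOver : ∀ {k} → List A → List (Vec A k) → Set
  AllWordsOver U ws = ∀ {w} → w ∈ ws → WordOver U w

  CountBound : ℕ → Set
  CountBound k = ∀ U → Unique U → (ws : List (Vec A k)) → Unique ws → AllWordsOver U ws →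
                 length ws ≤ fallingFactorial (length U) k

  -- The words with first letter u ∈ W ⊆ U are u followed by a word over U without u.
  count-by-heads : ∀ {k} → CountBound k → ∀ U → Unique U → (W : List A) → (∀ {u} → u ∈ W → u ∈ U) →
    (ws : List (Vec A (suc k))) → Unique ws → AllWordsOver U ws → (∀ {w} → w ∈ ws → head w ∈ W) →
    length ws ≤ length W * fallingFactorial (pred (length U)) k
  count-by-heads bound U uU [] W⊆U [] _ _ _ = z≤n
  count-by-heads bound U uU [] W⊆U (w ∷ ws) _ _ heads with heads (here refl)
  ... | ()
  count-by-heads {k} bound U uU (u ∷ W) W⊆U ws uws words heads = begin
    length ws                                 ≡⟨ length-splitByHead u ws ⟩
    length withU + length withoutU             ≤⟨ +-mono-≤ withU-bound withoutU-bound ⟩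
    fallingFactorial (pred (length U)) k + length W * fallingFactorial (pred (length U)) k ∎
    where
      open ≤-Reasoning
      withU : List (Vec A k)
      withU = proj₁ (splitByHead u ws)
      withoutU : List (Vec A (suc k))
      withoutU = proj₂ (splitByHead u ws)
      u∈U = W⊆U (here refl)

      withU-words : AllWordsOver (remove u U) withU
      withU-words {w} w∈ with words {u ∷ w} (∈-splitByHead₁ u ws w∈)
      ... | (u∉w ∷ distinct) , (_ ∷ over) =
        distinct , VecAll.map (λ (u≢x , x∈U) → ∈-remove⁺ U x∈U (u≢x ∘ sym)) (VecAll.zip (u∉w , over))

      withU-bound : length withU ≤ fallingFactorial (pred (length U)) k
      withU-bound = subst (λ n → length withU ≤ fallingFactorial n k) (cong pred (length-remove U u∈U))
        (bound (remove u U) (remove-unique U uU) withU (splitByHead-unique₁ u ws uws) withU-words)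

      withoutU-heads : ∀ {w} → w ∈ withoutU → head w ∈ W
      withoutU-heads w∈ with ∈-splitByHead₂ u ws w∈
      ... | w∈ws , head≢u with heads w∈ws
      ...   | here head≡u = ⊥-elim (head≢u head≡u)
      ...   | there h∈W   = h∈W

      withoutU-bound : length withoutU ≤ length W * fallingFactorial (pred (length U)) k
      withoutU-bound = count-by-heads bound U uU W (W⊆U ∘ there) withoutU (splitByHead-unique₂ u ws uws)
        (words ∘ proj₁ ∘ ∈-splitByHead₂ u ws) withoutU-heads

  count-words : ∀ k → CountBound k
  count-words zero U uU []            _             _     = z≤n
  count-words zero U uU ([] ∷ [])     _             _     = s≤s z≤n
  count-words zero U uU ([] ∷ [] ∷ _) ((≢[] ∷ _) ∷ _) _   = ⊥-elim (≢[] refl)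
  count-words (suc k) U uU ws uws words =
    count-by-heads (count-words k) U uU U (λ u∈ → u∈) ws uws words
      (λ { {_ ∷ _} w∈ → VecAll.head (proj₂ (words w∈)) })

-- Radius-one balls of the Kendall τ-distance

module Balls {A : Set} where

  swaps : ∀ {n} → Vec A n → List (Vec A n)
  swaps []           = []
  swaps (x ∷ [])     = []
  swaps (x ∷ y ∷ xs) = (y ∷ x ∷ xs) ∷ map (x ∷_) (swaps (y ∷ xs))

  ball : ∀ {n} → Vec A n → List (Vec A n)
  ball v = v ∷ swaps v

  balls : ∀ {n} → List (Vec A n) → List (Vec A n)
  balls vs = concat (map ball vs)

  ∈-swaps⇒AdjSwap : ∀ {n} {v w : Vec A n} → w ∈ swaps v → AdjSwap v w
  ∈-swaps⇒AdjSwap {v = x ∷ y ∷ xs} (here refl) = here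
  ∈-swaps⇒AdjSwap {v = x ∷ y ∷ xs} (there w∈) with ∈-map⁻ (x ∷_) w∈
  ... | w′ , w′∈ , refl = there (∈-swaps⇒AdjSwap w′∈)

  AdjSwap-sym : ∀ {n} {v w : Vec A n} → AdjSwap v w → AdjSwap w v
  AdjSwap-sym here      = here
  AdjSwap-sym (there s) = there (AdjSwap-sym s)

  AdjSwap-All : ∀ {P : A → Set} {n} {v w : Vec A n} → AdjSwap v w → VecAll.All P v → VecAll.All P w
  AdjSwap-All here      (px ∷ py ∷ pxs) = py ∷ px ∷ pxs
  AdjSwap-All (there s) (px ∷ pxs)      = px ∷ AdjSwap-All s pxs

  AdjSwap-Distinct : ∀ {n} {v w : Vec A n} → AdjSwap v w → Distinct v → Distinct w
  AdjSwap-Distinct here      ((x≢y ∷ x∉) ∷ y∉ ∷ d) = ((x≢y ∘ sym) ∷ y∉) ∷ x∉ ∷ d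
  AdjSwap-Distinct (there s) (x∉ ∷ d)             = AdjSwap-All s x∉ ∷ AdjSwap-Distinct s d

  AdjSwap⇒≢ : ∀ {n} {v w : Vec A n} → AdjSwap v w → Distinct v → v ≢ w
  AdjSwap⇒≢ here      ((x≢y ∷ _) ∷ _) v≡w = x≢y (Vec.∷-injectiveˡ v≡w)
  AdjSwap⇒≢ (there s) (_ ∷ d)         v≡w = AdjSwap⇒≢ s d (Vec.∷-injectiveʳ v≡w)

  swaps-unique : ∀ {n} (v : Vec A n) → Distinct v → Unique (swaps v)
  swaps-unique []           _ = []
  swaps-unique (x ∷ [])     _ = []
  swaps-unique (x ∷ y ∷ xs) ((x≢y ∷ _) ∷ d) =
    All.tabulate (λ w∈ → first≢ (∈-map⁻ (x ∷_) w∈))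
    ∷ Unique.map⁺ Vec.∷-injectiveʳ (swaps-unique (y ∷ xs) d)
    where
      first≢ : ∀ {w} → ∃[ w′ ] w′ ∈ swaps (y ∷ xs) × w ≡ x ∷ w′ → y ∷ x ∷ xs ≢ w
      first≢ (_ , _ , refl) y∷x∷xs≡ = x≢y (sym (Vec.∷-injectiveˡ y∷x∷xs≡))

  ball-unique : ∀ {n} {v : Vec A n} → Distinct v → Unique (ball v)
  ball-unique {v = v} d = All.tabulate (λ w∈ → AdjSwap⇒≢ (∈-swaps⇒AdjSwap w∈) d) ∷ swaps-unique v d

  ∈-ball-Distinct : ∀ {n} {v w : Vec A n} → Distinct v → w ∈ ball v → Distinct w
  ∈-ball-Distinct d (here refl) = d
  ∈-ball-Distinct d (there w∈)  = AdjSwap-Distinct (∈-swaps⇒AdjSwap w∈) d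

  balls-meet⇒Steps<3 : ∀ {n} {u v a : Vec A n} → a ∈ ball u → a ∈ ball v → ∃[ k ] k < 3 × Steps k u v
  balls-meet⇒Steps<3 (here refl) (here refl) = 0 , s≤s z≤n , done
  balls-meet⇒Steps<3 (here refl) (there a∈)  = 1 , s≤s (s≤s z≤n) , step (AdjSwap-sym (∈-swaps⇒AdjSwap a∈)) done
  balls-meet⇒Steps<3 (there a∈)  (here refl) = 1 , s≤s (s≤s z≤n) , step (∈-swaps⇒AdjSwap a∈) done
  balls-meet⇒Steps<3 (there a∈)  (there b∈)  =
    2 , s≤s (s≤s (s≤s z≤n)) , step (∈-swaps⇒AdjSwap a∈) (step (AdjSwap-sym (∈-swaps⇒AdjSwap b∈)) done)

  length-swaps : ∀ {n} (v : Vec A (suc n)) → length (swaps v) ≡ n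
  length-swaps (x ∷ [])     = refl
  length-swaps (x ∷ y ∷ xs) = cong suc (trans (length-map (x ∷_) (swaps (y ∷ xs))) (length-swaps (y ∷ xs)))

  Distance≥3 : ∀ {n} → Vec A n → Vec A n → Set
  Distance≥3 u v = ∀ k → k < 3 → ¬ Steps k u v

  balls-Distinct : ∀ {n} {vs : List (Vec A n)} → All Distinct vs → All Distinct (balls vs)
  balls-Distinct distinct = All.concat⁺ (All.map⁺ (All.map (λ d → All.tabulate (∈-ball-Distinct d)) distinct))

  balls-unique : ∀ {n} {vs : List (Vec A n)} → All Distinct vs → AllPairs Distance≥3 vs → Unique (balls vs)
  balls-unique distinct far =
    Unique.concat⁺ (All.map⁺ (All.map ball-unique distinct))
                   (AllPairs.map⁺ (AllPairs.map disjoint far))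
    where
      disjoint : ∀ {u v} → Distance≥3 u v → Disjoint (ball u) (ball v)
      disjoint far-uv (a∈u , a∈v) with balls-meet⇒Steps<3 a∈u a∈v
      ... | k , k<3 , steps = far-uv k k<3 steps

module MarkedPositions {A : Set} (_≟_ : DecidableEquality A) (t : A) where

  open Balls

  indicator : A → ℕ
  indicator x with x ≟ t
  ... | yes _ = 1
  ... | no  _ = 0

  indicator-≡ : ∀ {x} → x ≡ t → indicator x ≡ 1
  indicator-≡ {x} x≡t with x ≟ t
  ... | yes _   = refl
  ... | no  x≢t = ⊥-elim (x≢t x≡t)

  indicator-≢ : ∀ {x} → x ≢ t → indicator x ≡ 0
  indicator-≢ {x} x≢t with x ≟ t
  ... | yes x≡t = ⊥-elim (x≢t x≡t)
  ... | no  _   = refl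

  indicator≡1⇒≡ : ∀ {x} → indicator x ≡ 1 → x ≡ t
  indicator≡1⇒≡ {x} marked with x ≟ t
  ... | yes x≡t = x≡t

  -- Positions beyond the end of the vector are never marked.
  isAt : ∀ {n} → ℕ → Vec A n → ℕ
  isAt k       []       = 0
  isAt zero    (x ∷ xs) = indicator x
  isAt (suc k) (x ∷ xs) = isAt k xs

  isAt≡0⊎1 : ∀ {n} k (v : Vec A n) → isAt k v ≡ 0 ⊎ isAt k v ≡ 1
  isAt≡0⊎1 k       []       = inj₁ refl
  isAt≡0⊎1 zero    (x ∷ xs) with x ≟ t
  ... | yes _ = inj₂ refl
  ... | no  _ = inj₁ refl
  isAt≡0⊎1 (suc k) (x ∷ xs) = isAt≡0⊎1 k xs

  isAt≡1⇒∈ : ∀ {n} k (v : Vec A n) → isAt k v ≡ 1 → t ∈ᵥ v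
  isAt≡1⇒∈ zero    (x ∷ xs) marked = here (sym (indicator≡1⇒≡ marked))
  isAt≡1⇒∈ (suc k) (x ∷ xs) marked = there (isAt≡1⇒∈ k xs marked)

  countAt : ∀ {n} → ℕ → List (Vec A n) → ℕ
  countAt k []       = 0
  countAt k (v ∷ vs) = isAt k v + countAt k vs

  countAt-++ : ∀ {n} k (us vs : List (Vec A n)) → countAt k (us ++ vs) ≡ countAt k us + countAt k vs
  countAt-++ k []       vs = refl
  countAt-++ k (u ∷ us) vs = trans (cong (isAt k u +_) (countAt-++ k us vs)) (sym (+-assoc (isAt k u) _ _))

  countAt-map-∷ : ∀ {n} k x (vs : List (Vec A n)) → countAt (suc k) (map (x ∷_) vs) ≡ countAt k vs
  countAt-map-∷ k x []       = refl
  countAt-map-∷ k x (v ∷ vs) = cong (isAt k v +_) (countAt-map-∷ k x vs)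

  countAt-zero-map-∷ : ∀ {n} x (vs : List (Vec A n)) → countAt 0 (map (x ∷_) vs) ≡ length vs * indicator x
  countAt-zero-map-∷ x []       = refl
  countAt-zero-map-∷ x (v ∷ vs) = cong (indicator x +_) (countAt-zero-map-∷ x vs)

  -- The centre and the swaps not moving position k keep the entry at k; the swaps of k with a neighbour bring in that
  -- neighbour's entry. At an end position the missing neighbour is k itself, which accounts for its one extra swap.
  countAt-ball : ∀ L (v : Vec A (2 + L)) k → k < 2 + L →
    countAt k (ball v) ≡ isAt (pred k) v + L * isAt k v + isAt (rightNeighbour (2 + L) k) v
  countAt-ball zero    (x ∷ y ∷ []) zero          _ =
    solve 2 (λ a b → a :+ (b :+ con 0) := a :+ con 0 :+ b) refl (indicator x) (indicator y)
  countAt-ball zero    (x ∷ y ∷ []) (suc zero)    _ =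
    solve 2 (λ a b → b :+ (a :+ con 0) := a :+ con 0 :+ b) refl (indicator x) (indicator y)
  countAt-ball zero    (x ∷ y ∷ []) (suc (suc k)) (s≤s (s≤s ()))
  countAt-ball (suc L) (x ∷ y ∷ ys) zero          _ = begin
    a + (b + countAt 0 (map (x ∷_) (swaps (y ∷ ys))))
      ≡⟨ cong (λ z → a + (b + z))
           (trans (countAt-zero-map-∷ x (swaps (y ∷ ys))) (cong (_* a) (length-swaps (y ∷ ys)))) ⟩
    a + (b + suc L * a)
      ≡⟨ solve 3 (λ a b l → a :+ (b :+ (con 1 :+ l) :* a) := a :+ (con 1 :+ l) :* a :+ b) refl a b L ⟩
    a + suc L * a + b ∎
    where
      open ≡-Reasoning
      a = indicator x
      b = indicator y
  countAt-ball (suc L) (x ∷ y ∷ ys) (suc zero)    (s≤s k<n) = begin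
    b + (a + countAt 1 (map (x ∷_) (swaps (y ∷ ys))))
      ≡⟨ cong (λ z → b + (a + z)) (countAt-map-∷ 0 x (swaps (y ∷ ys))) ⟩
    b + (a + c)
      ≡⟨ solve 3 (λ a b c → b :+ (a :+ c) := a :+ (b :+ c)) refl a b c ⟩
    a + (b + c)
      ≡⟨ cong (a +_) (countAt-ball L (y ∷ ys) 0 k<n) ⟩
    a + (b + L * b + r)
      ≡⟨ solve 4 (λ a b l r → a :+ (b :+ l :* b :+ r) := a :+ (con 1 :+ l) :* b :+ r) refl a b L r ⟩
    a + suc L * b + r ∎
    where
      open ≡-Reasoning
      a = indicator x
      b = indicator y
      c = countAt 0 (swaps (y ∷ ys))
      r = isAt (rightNeighbour (2 + L) 0) (y ∷ ys)
  countAt-ball (suc L) (x ∷ y ∷ ys) (suc (suc k)) (s≤s k<n) = begin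
    s + (s + countAt (suc (suc k)) (map (x ∷_) (swaps (y ∷ ys))))
      ≡⟨ cong (λ z → s + (s + z)) (countAt-map-∷ (suc k) x (swaps (y ∷ ys))) ⟩
    s + (s + c)
      ≡⟨ cong (s +_) (countAt-ball L (y ∷ ys) (suc k) k<n) ⟩
    s + (l + L * s + r)
      ≡⟨ solve 4 (λ s l m r → s :+ (l :+ m :* s :+ r) := l :+ (con 1 :+ m) :* s :+ r) refl s l L r ⟩
    l + suc L * s + r ∎
    where
      open ≡-Reasoning
      s = isAt k ys
      l = isAt k (y ∷ ys)
      c = countAt (suc k) (swaps (y ∷ ys))
      r = isAt (rightNeighbour (2 + L) (suc k)) (y ∷ ys)

  countAt-balls : ∀ L k → k < 2 + L → (vs : List (Vec A (2 + L))) →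
    countAt k (balls vs) ≡ countAt (pred k) vs + L * countAt k vs + countAt (rightNeighbour (2 + L) k) vs
  countAt-balls L k k<n []       = solve 1 (λ l → con 0 := con 0 :+ l :* con 0 :+ con 0) refl L
  countAt-balls L k k<n (v ∷ vs) = begin
    countAt k (ball v ++ balls vs)            ≡⟨ countAt-++ k (ball v) (balls vs) ⟩
    countAt k (ball v) + countAt k (balls vs) ≡⟨ cong₂ _+_ (countAt-ball L v k k<n) (countAt-balls L k k<n vs) ⟩
    (a + L * b + c) + (a′ + L * b′ + c′)
      ≡⟨ solve 7 (λ a b c a′ b′ c′ l → (a :+ l :* b :+ c) :+ (a′ :+ l :* b′ :+ c′)
                                     := (a :+ a′) :+ l :* (b :+ b′) :+ (c :+ c′)) refl a b c a′ b′ c′ L ⟩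
    (a + a′) + L * (b + b′) + (c + c′) ∎
    where
      open ≡-Reasoning
      a  = isAt (pred k) v
      b  = isAt k v
      c  = isAt (rightNeighbour (2 + L) k) v
      a′ = countAt (pred k) vs
      b′ = countAt k vs
      c′ = countAt (rightNeighbour (2 + L) k) vs

  sumBelow-isAt-∉ : ∀ {n} {v : Vec A n} → VecAll.All (_≢ t) v → sumBelow n (λ k → isAt k v) ≡ 0
  sumBelow-isAt-∉ []                    = refl
  sumBelow-isAt-∉ {suc n} (x≢t ∷ x∉) =
    trans (sumBelow-suc n _) (cong₂ _+_ (indicator-≢ x≢t) (sumBelow-isAt-∉ x∉))

  sumBelow-isAt : ∀ {n} {v : Vec A n} → Distinct v → t ∈ᵥ v → sumBelow n (λ k → isAt k v) ≡ 1
  sumBelow-isAt {suc n} {x ∷ xs} (x∉ ∷ _) (here t≡x) = trans (sumBelow-suc n _)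
    (cong₂ _+_ (indicator-≡ (sym t≡x))
               (sumBelow-isAt-∉ (VecAll.map (λ x≢y y≡t → x≢y (trans (sym t≡x) (sym y≡t))) x∉)))
  sumBelow-isAt {suc n} {x ∷ xs} (x∉ ∷ d) (there t∈) = trans (sumBelow-suc n _)
    (cong₂ _+_ (indicator-≢ (λ x≡t → VecAll.lookup x∉ t∈ x≡t)) (sumBelow-isAt d t∈))

  sumBelow-countAt : ∀ {n} {vs : List (Vec A n)} → All (λ v → Distinct v × t ∈ᵥ v) vs →
    sumBelow n (λ k → countAt k vs) ≡ length vs
  sumBelow-countAt {n} []                  = trans (sumBelow-const n 0) (*-zeroʳ n)
  sumBelow-countAt {n} {v ∷ vs} ((d , t∈) ∷ rest) =
    trans (sumBelow-distrib-+ n (λ k → isAt k v) (λ k → countAt k vs))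
          (cong₂ _+_ (sumBelow-isAt d t∈) (sumBelow-countAt rest))

  deleteAt : ∀ {n} → ℕ → Vec A (suc n) → Vec A n
  deleteAt zero    (x ∷ xs)     = xs
  deleteAt (suc k) (x ∷ [])     = []
  deleteAt (suc k) (x ∷ y ∷ xs) = x ∷ deleteAt k (y ∷ xs)

  deleteAt-injective : ∀ {n} k (v w : Vec A (suc n)) → isAt k v ≡ 1 → isAt k w ≡ 1 →
    deleteAt k v ≡ deleteAt k w → v ≡ w
  deleteAt-injective zero    (x ∷ xs) (y ∷ ys) x≡t y≡t xs≡ys =
    cong₂ _∷_ (trans (indicator≡1⇒≡ x≡t) (sym (indicator≡1⇒≡ y≡t))) xs≡ys
  deleteAt-injective (suc k) (x ∷ y ∷ xs) (x′ ∷ y′ ∷ ys) v-marked w-marked v≡w =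
    cong₂ _∷_ (Vec.∷-injectiveˡ v≡w)
              (deleteAt-injective k (y ∷ xs) (y′ ∷ ys) v-marked w-marked (Vec.∷-injectiveʳ v≡w))

  deleteAt-All : ∀ {P : A → Set} {n} k {v : Vec A (suc n)} → VecAll.All P v → VecAll.All P (deleteAt k v)
  deleteAt-All zero    (_ ∷ pxs)            = pxs
  deleteAt-All (suc k) (_ ∷ [])             = []
  deleteAt-All (suc k) (px ∷ pxs@(_ ∷ _))   = px ∷ deleteAt-All k pxs

  deleteAt-Distinct : ∀ {n} k {v : Vec A (suc n)} → Distinct v → Distinct (deleteAt k v)
  deleteAt-Distinct zero    (_ ∷ d)             = d
  deleteAt-Distinct (suc k) (_ ∷ [])            = []
  deleteAt-Distinct (suc k) (x∉ ∷ d@(_ ∷ _))   = deleteAt-All k x∉ ∷ deleteAt-Distinct k d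

  deleteAt-unmarked : ∀ {n} k (v : Vec A (suc n)) → Distinct v → isAt k v ≡ 1 → VecAll.All (_≢ t) (deleteAt k v)
  deleteAt-unmarked zero    (x ∷ xs)     (x∉ ∷ _) marked =
    VecAll.map (λ x≢y y≡t → x≢y (trans (indicator≡1⇒≡ marked) (sym y≡t))) x∉
  deleteAt-unmarked (suc k) (x ∷ y ∷ xs) (x∉ ∷ d) marked =
    (λ x≡t → VecAll.lookup x∉ (isAt≡1⇒∈ k (y ∷ xs) marked) x≡t) ∷ deleteAt-unmarked k (y ∷ xs) d marked

  deleteMarkAt : ∀ {n} → ℕ → List (Vec A (suc n)) → List (Vec A n)
  deleteMarkAt k []       = []
  deleteMarkAt k (v ∷ vs) with isAt k v ≟ℕ 1
  ... | yes _ = deleteAt k v ∷ deleteMarkAt k vs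
  ... | no  _ = deleteMarkAt k vs

  length-deleteMarkAt : ∀ {n} k (vs : List (Vec A (suc n))) → length (deleteMarkAt k vs) ≡ countAt k vs
  length-deleteMarkAt k []       = refl
  length-deleteMarkAt k (v ∷ vs) with isAt k v ≟ℕ 1 | isAt≡0⊎1 k v
  ... | yes marked   | _              = trans (cong suc (length-deleteMarkAt k vs)) (cong (_+ countAt k vs) (sym marked))
  ... | no  _        | inj₁ unmarked  = trans (length-deleteMarkAt k vs) (cong (_+ countAt k vs) (sym unmarked))
  ... | no  unmarked | inj₂ marked    = ⊥-elim (unmarked marked)

  ∈-deleteMarkAt : ∀ {n} k (vs : List (Vec A (suc n))) {w} → w ∈ deleteMarkAt k vs →
    ∃[ v ] v ∈ vs × isAt k v ≡ 1 × w ≡ deleteAt k v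
  ∈-deleteMarkAt k (v ∷ vs) w∈ with isAt k v ≟ℕ 1
  ∈-deleteMarkAt k (v ∷ vs) (here w≡) | yes marked = v , here refl , marked , w≡
  ∈-deleteMarkAt k (v ∷ vs) (there w∈) | yes _     = map₂ (map₁ there) (∈-deleteMarkAt k vs w∈)
  ∈-deleteMarkAt k (v ∷ vs) w∈         | no  _     = map₂ (map₁ there) (∈-deleteMarkAt k vs w∈)

  deleteMarkAt-unique : ∀ {n} k (vs : List (Vec A (suc n))) → Unique vs → Unique (deleteMarkAt k vs)
  deleteMarkAt-unique k []       []          = []
  deleteMarkAt-unique k (v ∷ vs) (v∉ ∷ uvs) with isAt k v ≟ℕ 1
  ... | yes marked = All.tabulate distinct ∷ deleteMarkAt-unique k vs uvs
    where
      distinct : ∀ {w} → w ∈ deleteMarkAt k vs → deleteAt k v ≢ w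
      distinct w∈ eq with ∈-deleteMarkAt k vs w∈
      ... | v′ , v′∈ , marked′ , w≡ = All.lookup v∉ v′∈ (deleteAt-injective k v v′ marked marked′ (trans eq w≡))
  ... | no  _      = deleteMarkAt-unique k vs uvs

  -- Deleting the mark leaves a word with distinct letters from U, so the falling-factorial bound applies.
  countAt-bound : ∀ {n} (U : List A) → Unique U → (∀ {a} → a ≢ t → a ∈ U) →
    ∀ k (vs : List (Vec A (suc n))) → Unique vs → All Distinct vs → countAt k vs ≤ fallingFactorial (length U) n
  countAt-bound {n} U uU ≢t⇒∈U k vs uvs distinct = begin
    countAt k vs                     ≡⟨ sym (length-deleteMarkAt k vs) ⟩
    length (deleteMarkAt k vs)       ≤⟨ count-words n U uU (deleteMarkAt k vs) (deleteMarkAt-unique k vs uvs) words ⟩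
    fallingFactorial (length U) n    ∎
    where
      open ≤-Reasoning
      open DistinctWords _≟_
      words : AllWordsOver U (deleteMarkAt k vs)
      words w∈ with ∈-deleteMarkAt k vs w∈
      ... | v , v∈ , marked , refl =
        deleteAt-Distinct k (All.lookup distinct v∈) ,
        VecAll.map ≢t⇒∈U (deleteAt-unmarked k v (All.lookup distinct v∈) marked)

perm-injective : ∀ {n} (π : Permutation′ n) {i j} → π ⟨$⟩ʳ i ≡ π ⟨$⟩ʳ j → i ≡ j
perm-injective π πi≡πj = trans (sym (inverseˡ π)) (trans (cong (π ⟨$⟩ˡ_) πi≡πj) (inverseˡ π))

oneLine-Distinct : ∀ {n} (π : Permutation′ n) → Distinct (oneLine π)
oneLine-Distinct π = Distinct.tabulate⁺ (perm-injective π)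

∈-oneLine : ∀ {n} (π : Permutation′ n) a → a ∈ᵥ oneLine π
∈-oneLine π a = subst (_∈ᵥ oneLine π) (inverseʳ π) (∈-tabulate⁺ (π ⟨$⟩ʳ_) (π ⟨$⟩ˡ a))

nonzeroFin : ∀ m → List (Fin (suc m))
nonzeroFin m = map suc (allFin m)

nonzeroFin-unique : ∀ m → Unique (nonzeroFin m)
nonzeroFin-unique m = Unique.map⁺ Fin-suc-injective (Unique.allFin⁺ m)

length-nonzeroFin : ∀ m → length (nonzeroFin m) ≡ m
length-nonzeroFin m = trans (length-map suc (allFin m)) (length-tabulate (λ i → i))

≢zero⇒∈nonzeroFin : ∀ {m} {a : Fin (suc m)} → a ≢ zero → a ∈ nonzeroFin m
≢zero⇒∈nonzeroFin {a = zero}  a≢0 = ⊥-elim (a≢0 refl)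
≢zero⇒∈nonzeroFin {a = suc i} _   = ∈-map⁺ suc (∈-allFin i)

countAt-zero≤ : ∀ {m} k (vs : List (Vec (Fin (suc m)) (suc m))) → Unique vs → All Distinct vs →
  MarkedPositions.countAt _≟F_ zero k vs ≤ m !
countAt-zero≤ {m} k vs uvs distinct = begin
  countAt k vs
    ≤⟨ countAt-bound (nonzeroFin m) (nonzeroFin-unique m) ≢zero⇒∈nonzeroFin k vs uvs distinct ⟩
  fallingFactorial (length (nonzeroFin m)) m
    ≡⟨ cong (λ n → fallingFactorial n m) (length-nonzeroFin m) ⟩
  fallingFactorial m m
    ≡⟨ fallingFactorial-n-n m ⟩
  m ! ∎
  where
    open ≤-Reasoning
    open MarkedPositions _≟F_ zero

code-bound : ∀ {p} → Prime p → 5 ≤ p → (C : List (Permutation′ p)) → IsCode p 3 C →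
  3 * length C + p ≤ 3 * ((p ∸ 1) ! + 1)
code-bound {suc (suc L)} p-prime (s≤s (s≤s 3≤L)) C isCode with wilson p-prime
... | divides q F+1≡qp = begin
  3 * length C + p                    ≡⟨ cong (λ n → 3 * n + p) (sym size≡sum) ⟩
  3 * sumBelow p c + p                ≤⟨ averaging-bound L q c 3≤L local ⟩
  3 * (p * q)                         ≡⟨ cong (3 *_) (trans (*-comm p q) (sym F+1≡qp)) ⟩
  3 * ((p ∸ 1) ! + 1)                 ∎
  where
    open ≤-Reasoning
    open Balls
    open MarkedPositions _≟F_ zero
    p = suc (suc L)
    V = map oneLine C
    c : ℕ → ℕ
    c j = countAt j V

    size≡sum : sumBelow p c ≡ length C
    size≡sum = trans (sumBelow-countAt (All.map⁺ (All.universal (λ π → oneLine-Distinct π , ∈-oneLine π zero) C)))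
                     (length-map oneLine C)

    distinctV : All Distinct V
    distinctV = All.map⁺ (All.universal oneLine-Distinct C)

    balls-V-unique : Unique (balls V)
    balls-V-unique = balls-unique distinctV (AllPairs.map⁺ (AllPairs.map proj₂ isCode))

    local : ∀ j → j < p → c (pred j) + L * c j + c (rightNeighbour p j) < p * q
    local j j<p = begin-strict
      c (pred j) + L * c j + c (rightNeighbour p j)   ≡⟨ sym (countAt-balls L j j<p V) ⟩
      countAt j (balls V)                             ≤⟨ countAt-zero≤ j (balls V) balls-V-unique (balls-Distinct distinctV) ⟩
      (p ∸ 1) !                                       <⟨ m<m+n _ (s≤s z≤n) ⟩
      (p ∸ 1) ! + 1                                   ≡⟨ trans F+1≡qp (*-comm q p) ⟩
      p * q                                           ∎

-- (p + 2) / 3 is ⌈p / 3⌉.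
code-bound⇒ceiling-bound : ∀ p F N → 3 * N + p ≤ 3 * (F + 1) → N ≤ F ∸ (p + 2) / 3 + 2
code-bound⇒ceiling-bound p F N 3N+p≤ = begin
  N                 ≤⟨ m+n≤o⇒m≤o∸n N N+d≤F+1 ⟩
  (F + 1) ∸ d       ≤⟨ m≤n+o⇒m∸n≤o (F + 1) d F+1≤d+[F∸d+2] ⟩
  F ∸ d + 2         ∎
  where
    open ≤-Reasoning
    d = (p + 2) / 3
    3[N+d]<3[F+2] : 3 * (N + d) < 3 * (F + 1 + 1)
    3[N+d]<3[F+2] = begin-strict
      3 * (N + d)       ≡⟨ *-distribˡ-+ 3 N d ⟩
      3 * N + 3 * d     ≤⟨ +-monoʳ-≤ (3 * N) (subst (_≤ p + 2) (*-comm d 3) (m/n*n≤m (p + 2) 3)) ⟩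
      3 * N + (p + 2)   ≡⟨ sym (+-assoc (3 * N) p 2) ⟩
      3 * N + p + 2     ≤⟨ +-monoˡ-≤ 2 3N+p≤ ⟩
      3 * (F + 1) + 2   <⟨ +-monoʳ-< (3 * (F + 1)) (n<1+n 2) ⟩
      3 * (F + 1) + 3   ≡⟨ solve 1 (λ f → con 3 :* (f :+ con 1) :+ con 3 := con 3 :* (f :+ con 1 :+ con 1)) refl F ⟩
      3 * (F + 1 + 1)   ∎
    F+1≤d+[F∸d+2] : F + 1 ≤ d + (F ∸ d + 2)
    F+1≤d+[F∸d+2] = begin
      F + 1               ≤⟨ +-mono-≤ (m≤n+m∸n F d) (n≤1+n 1) ⟩
      d + (F ∸ d) + 2     ≡⟨ +-assoc d (F ∸ d) 2 ⟩
      d + (F ∸ d + 2)     ∎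
    N+d≤F+1 : N + d ≤ F + 1
    N+d≤F+1 = s≤s⁻¹ (subst (N + d <_) (+-comm (F + 1) 1) (*-cancelˡ-< 3 _ _ 3[N+d]<3[F+2]))

ceiling-bound≤ : ∀ p F → 10 ≤ p → 4 ≤ F → F ∸ (p + 2) / 3 + 2 ≤ F ∸ 2
ceiling-bound≤ p F 10≤p 4≤F = begin
  F ∸ (p + 2) / 3 + 2   ≤⟨ +-monoˡ-≤ 2 (∸-monoʳ-≤ F (/-monoˡ-≤ 3 (+-monoˡ-≤ 2 10≤p))) ⟩
  F ∸ 4 + 2             ≡⟨ cong (_+ 2) (sym (∸-+-assoc F 2 2)) ⟩
  F ∸ 2 ∸ 2 + 2         ≡⟨ m∸n+n≡m (m+n≤o⇒m≤o∸n 2 4≤F) ⟩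
  F ∸ 2                 ∎
  where open ≤-Reasoning

n≤n! : ∀ n → n ≤ n !
n≤n! zero    = z≤n
n≤n! (suc n) = subst (_≤ suc n * n !) (*-identityʳ (suc n)) (*-monoʳ-≤ (suc n) (1≤n! n))

mainTheorem1 : (p : ℕ) → Prime p → 11 ≤ p →
    PAtMost p 3 (((p ∸ 1) !) ∸ ((p + 2) / 3) + 2)
    × (((p ∸ 1) !) ∸ ((p + 2) / 3) + 2 ≤ ((p ∸ 1) !) ∸ 2)
mainTheorem1 p p-prime 11≤p =
    (λ C isCode → code-bound⇒ceiling-bound p ((p ∸ 1) !) (length C)
                    (code-bound p-prime (≤-trans (m≤m+n 5 6) 11≤p) C isCode))
  , ceiling-bound≤ p ((p ∸ 1) !) (≤-trans (n≤1+n 10) 11≤p) 4≤[p∸1]!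
  where
    4≤[p∸1]! : 4 ≤ (p ∸ 1) !
    4≤[p∸1]! = ≤-trans (m≤m+n 4 6) (≤-trans (∸-monoˡ-≤ 1 11≤p) (n≤n! (p ∸ 1)))
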